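{- For all $n\in\mathbb{N}$ with $n\ge1$ and all $X\in\mathrm{IS}$: if $X$ computes $\mathrm{tstnz}_n$, then $\mathrm{len}(X)\ge L(n)$, where $L(n)=3n/2+1$ if $n$ is even and $L(n)=3(n+1)/2$ if $n$ is odd.
   Context: Basic instructions: $\mathtt{in}{:}i.\mathtt{get}$ ($i\ge1$), $\mathtt{out}.\mathtt{set}{:}b$ ($b\in\{0,1\}$), $\mathtt{aux}{:}i.\mathtt{get}$ ($i\ge1$), $\mathtt{aux}{:}i.\mathtt{set}{:}b$ ($i\ge1$, $b\in\{0,1\}$). The part before the dot names a Boolean register ($\mathtt{in}{:}i$ input, $\mathtt{out}$ output, $\mathtt{aux}{:}i$ auxiliary); $\mathtt{get}$ changes nothing and replies the content, $\mathtt{set}{:}b$ makes the content $b$ and replies $b$. Primitive instructions: for each basic instruction $a$, plain $a$, positive test $+a$, negative test $-a$; forward jumps $\#l$ ($l\in\mathbb{N}$); termination $!$. $\mathrm{IS}$ is the set of finite sequences $X=u_1;\dots;u_k$ of primitive instructions, $\mathrm{len}(X)=k$. Execution starts at $u_1$: plain $a$ executes $a$ and proceeds with the next instruction; $+a$ executes $a$ and proceeds with the next instruction if the reply is $1$, otherwise skips the next one and proceeds with the one after it; $-a$ likewise with replies reversed; $\#l$ proceeds with the $l$-th next instruction; $!$ terminates. If $l=0$ or there is no instruction to proceed with, execution never terminates. For $f:\{0,1\}^n\to\{0,1\}$, $X$ computes $f$ if there is $k$ such that for all $b_1,\dots,b_n$, executing $X$ with $\mathtt{in}{:}i$ initially $b_i$,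 $\mathtt{out}$ and $\mathtt{aux}{:}1,\dots,\mathtt{aux}{:}k$ initially $0$ (other registers arbitrary) terminates with final content of $\mathtt{out}$ equal to $f(b_1,\dots,b_n)$. $\mathrm{tstnz}_n:\{0,1\}^n\to\{0,1\}$: $\mathrm{tstnz}_n(b_1,\dots,b_n)=1$ iff some $b_i=1$. -}

module Defs where

open import Data.Nat using (ℕ; zero; suc; _+_; _*_; _≤_; _<_; _/_; _%_; _≡ᵇ_)
open import Data.Bool using (Bool; true; false; if_then_else_; not; _∨_)
open import Data.List using (List; []; _∷_; length; drop)
open import Data.Maybe using (Maybe; just; nothing)
open import Data.Vec using (Vec; lookup)
open import Data.Fin using (Fin; toℕ)
open import Data.Product using (Σ; _×_; _,_)
open import Relation.Binary.PropositionalEquality using (_≡_)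

-- Register indices: an index i : ℕ denotes register number (suc i),
-- so in:1, in:2, ... are  inR 0, inR 1, ...; likewise for aux.

data Basic : Set where
  inGet  : ℕ → Basic
  outSet : Bool → Basic
  auxGet : ℕ → Basic
  auxSet : ℕ → Bool → Basic

data Prim : Set where
  plain : Basic → Prim
  ptest : Basic → Prim
  ntest : Basic → Prim
  jump  : ℕ → Prim
  halt  : Prim

IS : Set
IS = List Prim

len : IS → ℕ
len = length

record State : Set where
  constructor st
  field
    inR  : ℕ → Bool
    outR : Bool
    auxR : ℕ → Bool
open State public

update : (ℕ → Bool) → ℕ → Bool → (ℕ → Bool)
update f i b j = if j ≡ᵇ i then b else f j

basic : Basic → State → Bool × State
basic (inGet i)    s = inR s i , s
basic (outSet b)   s = b , st (inR s) b (auxR s)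
basic (auxGet i)   s = auxR s i , s
basic (auxSet i b) s = b , st (inR s) (outR s) (update (auxR s) i b)

-- Execution of the remaining instruction sequence (its head is the current
-- instruction). Every step moves strictly forward, so 'fuel ≥ length'
-- suffices; 'nothing' means the execution does not terminate
-- (jump #0, or no instruction to proceed with).
run : ℕ → IS → State → Maybe State
run zero    _ _ = nothing
run (suc f) [] s = nothing
run (suc f) (halt ∷ xs) s = just s
run (suc f) (jump zero ∷ xs) s = nothing
run (suc f) (jump (suc l) ∷ xs) s = run f (drop l xs) s
run (suc f) (plain a ∷ xs) s with basic a s
... | _ , s' = run f xs s'
run (suc f) (ptest a ∷ xs) s with basic a s
... | true  , s' = run f xs s'
... | false , s' = run f (drop 1 xs) s'
run (suc f) (ntest a ∷ xs) s with basic a s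
... | false , s' = run f xs s'
... | true  , s' = run f (drop 1 xs) s'

exec : IS → State → Maybe State
exec X s = run (suc (len X)) X s

Computes : (n : ℕ) → IS → (Vec Bool n → Bool) → Set
Computes n X f =
  Σ ℕ λ k → (b : Vec Bool n) → (inp aux : ℕ → Bool) →
    ((i : Fin n) → inp (toℕ i) ≡ lookup b i) →
    ((i : ℕ) → i < k → aux i ≡ false) →
    Σ State λ s' → (exec X (st inp false aux) ≡ just s') × (outR s' ≡ f b)

tstnz : (n : ℕ) → Vec Bool n → Bool
tstnz zero    _ = false
tstnz (suc n) (x Data.Vec.∷ xs) = x ∨ tstnz n xs

L : ℕ → ℕ
L n = if n % 2 ≡ᵇ 0 then 3 * n / 2 + 1 else 3 * (n + 1) / 2

{-# OPTIONS --safe #-}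

-- Compare the run of X on the zero input with its runs on the unit inputs e_j: the run on e_j
-- agrees with the zero run until it tests in:j, and must leave it there, its output being 1.
-- Following the zero run, let J be the indices whose runs have not left yet. Then L |J| is at
-- most the number of remaining instructions, and L (|J| + 1) is at most that number plus one
-- if moreover the run on some e_p (p ∉ J) is one instruction ahead, having skipped it after a
-- test -in:p. Both bounds hold by induction on the zero run: a test +in:k with k ∈ J also costs
-- the instruction the zero run skips, while a test -in:k puts e_k ahead, the run ahead (if any)
-- rejoining J. As L (m + 2) = L m + 3, two indices cost three instructions.
module Submission where

open import Defs
open import Data.Nat using (ℕ; zero; suc; _+_; _*_; _/_; _%_; _≤_; _<_; _≡ᵇ_; _≟_; z≤n; s≤s)
open import Data.Nat.Divisibility using (divides)
open import Data.Nat.DivMod using (/-congˡ; +-distrib-/-∣ˡ)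
open import Data.Nat.Properties
  using ( ≤-refl; ≤-reflexive; ≤-trans; n≤1+n; m≤n⇒m≤1+n; m∸n≤m; +-monoʳ-≤; *-distribˡ-+
        ; module ≤-Reasoning)
open import Data.Bool using (Bool; true; false; not; if_then_else_; _∨_)
open import Data.Bool.Properties using (if-float; ∨-zeroʳ)
open import Data.Empty using (⊥-elim)
open import Data.Unit using (⊤)
open import Data.Fin as Fin using (Fin; toℕ; fromℕ<)
open import Data.Fin.Properties using (toℕ-fromℕ<)
open import Data.List using (List; []; _∷_; length; drop; downFrom)
open import Data.List.Properties using (length-drop; length-removeAt′; length-downFrom)
open import Data.List.Membership.Propositional using (_∈_)
open import Data.List.Membership.Propositional.Properties using (∈-downFrom⁻)
open import Data.List.Membership.DecPropositional _≟_ using (_∈?_)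
open import Data.List.Relation.Unary.Any using (here; there; _─_)
open import Data.List.Relation.Unary.All as All using (All; []; _∷_; universal)
open import Data.List.Relation.Unary.All.Properties using (─⁺; ¬Any⇒All¬)
open import Data.List.Relation.Unary.AllPairs as AllPairs using (_∷_)
open import Data.List.Relation.Unary.Unique.Propositional using (Unique)
open import Data.List.Relation.Unary.Unique.Propositional.Properties using (downFrom⁺)
open import Data.Maybe using (Maybe; just; nothing)
open import Data.Product using (_,_; proj₁; proj₂)
open import Data.Vec using (tabulate)
open import Data.Vec.Properties using (lookup∘tabulate)
open import Function using (_∘_)
open import Relation.Binary.PropositionalEquality
open import Relation.Nullary using (yes; no)
open import Relation.Nullary.Decidable using (dec-true; dec-false)

length-drop≤ : ∀ {A : Set} l (xs : List A) → length (drop l xs) ≤ length xs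
length-drop≤ l xs = ≤-trans (≤-reflexive (length-drop l xs)) (m∸n≤m (length xs) l)

∷─-unique : ∀ {A : Set} {x : A} {xs} (x∈xs : x ∈ xs) → Unique xs → Unique (x ∷ (xs ─ x∈xs))
∷─-unique (here refl)  uniq = uniq
∷─-unique (there x∈xs) (y#xs ∷ uniq) with ∷─-unique x∈xs uniq
... | x#xs′ ∷ uniq′ = (≢-sym (All.lookup y#xs x∈xs) ∷ x#xs′) ∷ (─⁺ x∈xs y#xs ∷ uniq′)

update-self : ∀ f j b → update f j b j ≡ b
update-self f j b = cong (λ c → if c then b else f j) (dec-true (j ≟ j) refl)

update-other : ∀ f {i j} b → i ≢ j → update f j b i ≡ f i
update-other f {i} {j} b i≢j = cong (λ c → if c then b else f i) (dec-false (i ≟ j) i≢j)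

3*[2+m]/2 : ∀ m → 3 * (2 + m) / 2 ≡ 3 + 3 * m / 2
3*[2+m]/2 m =
  trans (/-congˡ {o = 2} (*-distribˡ-+ 3 2 m)) (+-distrib-/-∣ˡ (3 * m) {2} (divides 3 refl))

L-+2 : ∀ n → L (2 + n) ≡ 3 + L n
L-+2 n = begin
  (if n % 2 ≡ᵇ 0 then 3 * (2 + n) / 2 + 1 else 3 * (2 + (n + 1)) / 2)
    ≡⟨ cong₂ (λ e o → if n % 2 ≡ᵇ 0 then e + 1 else o) (3*[2+m]/2 n) (3*[2+m]/2 (n + 1)) ⟩
  (if n % 2 ≡ᵇ 0 then 3 + (3 * n / 2 + 1) else 3 + 3 * (n + 1) / 2)
    ≡⟨ if-float (3 +_) (n % 2 ≡ᵇ 0) ⟨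
  3 + L n ∎
  where open ≡-Reasoning

L-suc≤ : ∀ n → L (suc n) ≤ 2 + L n
L-suc≤ 0 = ≤-refl
L-suc≤ 1 = n≤1+n 4
L-suc≤ (suc (suc n)) = begin
  L (3 + n)      ≡⟨ L-+2 (suc n) ⟩
  3 + L (suc n)  ≤⟨ +-monoʳ-≤ 3 (L-suc≤ n) ⟩
  2 + (3 + L n)  ≡⟨ cong (2 +_) (L-+2 n) ⟨
  2 + L (2 + n)  ∎
  where open ≤-Reasoning

effect : Prim → State → State
effect (plain a) s = proj₂ (basic a s)
effect (ptest a) s = proj₂ (basic a s)
effect (ntest a) s = proj₂ (basic a s)
effect _         s = s

data Control : Set where
  halts diverges : Control
  continue       : IS → Control

branch : Bool → IS → Control
branch true  xs = continue xs
branch false xs = continue (drop 1 xs)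

control : Prim → IS → State → Control
control (plain _)      xs s = continue xs
control (ptest a)      xs s = branch (proj₁ (basic a s)) xs
control (ntest a)      xs s = branch (not (proj₁ (basic a s))) xs
control (jump zero)    xs s = diverges
control (jump (suc l)) xs s = continue (drop l xs)
control halt           xs s = halts

resume : ℕ → Control → State → Maybe State
resume f halts         s = just s
resume f diverges      s = nothing
resume f (continue ys) s = run f ys s

run-∷ : ∀ f x xs s → run (suc f) (x ∷ xs) s ≡ resume f (control x xs s) (effect x s)
run-∷ f (plain a)      xs s = refl
run-∷ f (ptest a)      xs s with basic a s
... | true  , _ = refl
... | false , _ = refl
run-∷ f (ntest a)      xs s with basic a s
... | true  , _ = refl
... | false , _ = refl
run-∷ f (jump zero)    xs s = refl
run-∷ f (jump (suc l)) xs s = refl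
run-∷ f halt           xs s = refl

branch≢halts : ∀ b {xs} → branch b xs ≢ halts
branch≢halts true  ()
branch≢halts false ()

control-halts : ∀ {x xs s} → control x xs s ≡ halts → x ≡ halt
control-halts {plain _}              ()
control-halts {ptest a} {s = s} h = ⊥-elim (branch≢halts (proj₁ (basic a s)) h)
control-halts {ntest a} {s = s} h = ⊥-elim (branch≢halts (not (proj₁ (basic a s))) h)
control-halts {jump zero}            ()
control-halts {jump (suc _)}         ()
control-halts {halt}                 _ = refl

branch-shortens : ∀ b {xs ys} → branch b xs ≡ continue ys → length ys ≤ length xs
branch-shortens true       refl = ≤-refl
branch-shortens false {xs} refl = length-drop≤ 1 xs

control-shortens : ∀ x {xs s ys} → control x xs s ≡ continue ys → length ys ≤ length xs
control-shortens (plain _)      refl = ≤-refl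
control-shortens (ptest a) {s = s} = branch-shortens (proj₁ (basic a s))
control-shortens (ntest a) {s = s} = branch-shortens (not (proj₁ (basic a s)))
control-shortens (jump (suc l)) {xs} refl = length-drop≤ l xs

-- Terminating execution as an inductive relation, so that induction can follow the zero run.
data Yields : IS → State → Bool → Set where
  halted    : ∀ {xs s b} → outR s ≡ b → Yields (halt ∷ xs) s b
  continued : ∀ {x xs s ys b} → control x xs s ≡ continue ys → Yields ys (effect x s) b →
              Yields (x ∷ xs) s b

run⇒Yields : ∀ f xs s {t} → run f xs s ≡ just t → Yields xs s (outR t)
run⇒Yields zero    _        _ ()
run⇒Yields (suc f) []       _ ()
run⇒Yields (suc f) (x ∷ xs) s e with control x xs s in c | trans (sym (run-∷ f x xs s)) e
... | halts       | refl with refl ← control-halts {x} {xs} {s} c = halted refl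
... | continue ys | e′ = continued c (run⇒Yields f ys (effect x s) e′)

Yields-continue : ∀ {x xs s ys b} → control x xs s ≡ continue ys → Yields (x ∷ xs) s b →
                  Yields ys (effect x s) b
Yields-continue c (continued c′ y) with trans (sym c) c′
... | refl = y

Yields-halt : ∀ {xs s b} → Yields (halt ∷ xs) s b → outR s ≡ b
Yields-halt (halted o) = o

Yields-length : ∀ {xs s b} → Yields xs s b → length xs ≡ suc (length (drop 1 xs))
Yields-length (halted _)      = refl
Yields-length (continued _ _) = refl

Yields-nonempty : ∀ {xs s b} → Yields xs s b → 1 ≤ length xs
Yields-nonempty (halted _)      = s≤s z≤n
Yields-nonempty (continued _ _) = s≤s z≤n

setInput : State → ℕ → State
setInput s j = st (update (inR s) j true) (outR s) (auxR s)

basic-inR : ∀ a s → inR (proj₂ (basic a s)) ≡ inR s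
basic-inR (inGet _)    s = refl
basic-inR (outSet _)   s = refl
basic-inR (auxGet _)   s = refl
basic-inR (auxSet _ _) s = refl

effect-inR : ∀ x s → inR (effect x s) ≡ inR s
effect-inR (plain a) = basic-inR a
effect-inR (ptest a) = basic-inR a
effect-inR (ntest a) = basic-inR a
effect-inR (jump _)  s = refl
effect-inR halt      s = refl

basic-setInput : ∀ a s j → proj₂ (basic a (setInput s j)) ≡ setInput (proj₂ (basic a s)) j
basic-setInput (inGet _)    s j = refl
basic-setInput (outSet _)   s j = refl
basic-setInput (auxGet _)   s j = refl
basic-setInput (auxSet _ _) s j = refl

effect-setInput : ∀ x s j → effect x (setInput s j) ≡ setInput (effect x s) j
effect-setInput (plain a) = basic-setInput a
effect-setInput (ptest a) = basic-setInput a
effect-setInput (ntest a) = basic-setInput a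
effect-setInput (jump _)  s j = refl
effect-setInput halt      s j = refl

Ignores : Basic → ℕ → Set
Ignores (inGet i) j = i ≢ j
Ignores _         _ = ⊤

Avoids : Prim → ℕ → Set
Avoids (ptest a) = Ignores a
Avoids (ntest a) = Ignores a
Avoids _         = λ _ → ⊤

reply-setInput : ∀ a s j → Ignores a j → proj₁ (basic a (setInput s j)) ≡ proj₁ (basic a s)
reply-setInput (inGet i)    s j i≢j = update-other (inR s) true i≢j
reply-setInput (outSet _)   s j _   = refl
reply-setInput (auxGet _)   s j _   = refl
reply-setInput (auxSet _ _) s j _   = refl

control-setInput : ∀ x xs s j → Avoids x j → control x xs (setInput s j) ≡ control x xs s
control-setInput (plain _)      xs s j _  = refl
control-setInput (ptest a)      xs s j av = cong (λ b → branch b xs) (reply-setInput a s j av)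
control-setInput (ntest a)      xs s j av = cong (λ b → branch (not b) xs) (reply-setInput a s j av)
control-setInput (jump zero)    xs s j _  = refl
control-setInput (jump (suc _)) xs s j _  = refl
control-setInput halt           xs s j _  = refl

data TestView (J : List ℕ) : Prim → Set where
  test⁺  : ∀ {k} → k ∈ J → TestView J (ptest (inGet k))
  test⁻  : ∀ {k} → k ∈ J → TestView J (ntest (inGet k))
  avoids : ∀ {x} → All (Avoids x) J → TestView J x

testView : ∀ J x → TestView J x
testView J (ptest (inGet k)) with k ∈? J
... | yes k∈J = test⁺ k∈J
... | no  k∉J = avoids (¬Any⇒All¬ J k∉J)
testView J (ntest (inGet k)) with k ∈? J
... | yes k∈J = test⁻ k∈J
... | no  k∉J = avoids (¬Any⇒All¬ J k∉J)
testView J (ptest (outSet _))   = avoids (universal _ J)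
testView J (ptest (auxGet _))   = avoids (universal _ J)
testView J (ptest (auxSet _ _)) = avoids (universal _ J)
testView J (ntest (outSet _))   = avoids (universal _ J)
testView J (ntest (auxGet _))   = avoids (universal _ J)
testView J (ntest (auxSet _ _)) = avoids (universal _ J)
testView J (plain _)            = avoids (universal _ J)
testView J (jump _)             = avoids (universal _ J)
testView J halt                 = avoids (universal _ J)

Clear : State → Set
Clear s = ∀ i → inR s i ≡ false

Clear-effect : ∀ x {s} → Clear s → Clear (effect x s)
Clear-effect x {s} clear i = trans (cong-app (effect-inR x s) i) (clear i)

Accepts : IS → State → ℕ → Set
Accepts xs s j = Yields xs (setInput s j) true

Accepts-continue : ∀ {x xs s ys j} → control x xs s ≡ continue ys → Avoids x j →
                   Accepts (x ∷ xs) s j → Accepts ys (effect x s) j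
Accepts-continue {x} {xs} {s} {ys} {j} c av acc =
  subst (λ t → Yields ys t true) (effect-setInput x s j)
        (Yields-continue (trans (control-setInput x xs s j av) c) acc)

All-Accepts-continue : ∀ {x xs s ys J} → control x xs s ≡ continue ys → All (Avoids x) J →
                       All (Accepts (x ∷ xs) s) J → All (Accepts ys (effect x s)) J
All-Accepts-continue c avs accs =
  All.zipWith (λ (av , acc) → Accepts-continue c av acc) (avs , accs)

control-test⁺ : ∀ {k xs s} → Clear s → control (ptest (inGet k)) xs s ≡ continue (drop 1 xs)
control-test⁺ {k} {xs} {s} clear = cong (λ b → branch b xs) (clear k)

control-test⁺-self : ∀ {k xs s} → control (ptest (inGet k)) xs (setInput s k) ≡ continue xs
control-test⁺-self {k} {xs} {s} = cong (λ b → branch b xs) (update-self (inR s) k true)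

control-test⁻ : ∀ {k xs s} → Clear s → control (ntest (inGet k)) xs s ≡ continue xs
control-test⁻ {k} {xs} {s} clear = cong (λ b → branch (not b) xs) (clear k)

control-test⁻-self : ∀ {k xs s} →
                     control (ntest (inGet k)) xs (setInput s k) ≡ continue (drop 1 xs)
control-test⁻-self {k} {xs} {s} = cong (λ b → branch (not b) xs) (update-self (inR s) k true)

mutual
  length-lower-bound : ∀ {xs s J} → Clear s → Unique J → Yields xs s false →
                       All (Accepts xs s) J → L (length J) ≤ length xs
  length-lower-bound _ _ (halted _) [] = s≤s z≤n
  length-lower-bound _ _ (halted o) (acc ∷ _) with trans (sym o) (Yields-halt acc)
  ... | ()
  length-lower-bound {s = s} {J} clear uniq (continued {x} {xs} c z) accs with testView J x
  ... | test⁺ k∈J = begin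
    L (length J)                ≡⟨ cong L (length-removeAt′ J _) ⟩
    L (suc (length (J ─ k∈J)))  ≤⟨ L-suc≤ (length (J ─ k∈J)) ⟩
    2 + L (length (J ─ k∈J))    ≤⟨ s≤s (length-lower-bound-test⁺ k∈J clear uniq c z accs) ⟩
    suc (length xs)             ∎
    where open ≤-Reasoning
  ... | test⁻ {k} k∈J with refl ← trans (sym (control-test⁻ {k} {xs} {s} clear)) c = begin
    L (length J)                ≡⟨ cong L (length-removeAt′ J _) ⟩
    L (suc (length (J ─ k∈J)))  ≤⟨ length-lower-bound-pending clear uniq⁺ z accs′ k-run ⟩
    suc (length xs)             ∎
    where
    open ≤-Reasoning
    uniq⁺ : Unique (k ∷ (J ─ k∈J))
    uniq⁺ = ∷─-unique k∈J uniq
    accs′ : All (Accepts xs s) (J ─ k∈J)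
    accs′ = All-Accepts-continue c (AllPairs.head uniq⁺) (─⁺ k∈J accs)
    k-run : Accepts (drop 1 xs) s k
    k-run = Yields-continue (control-test⁻-self {k} {xs} {s}) (All.lookup accs k∈J)
  ... | avoids av = m≤n⇒m≤1+n (≤-trans
    (length-lower-bound (Clear-effect x clear) uniq z (All-Accepts-continue c av accs))
    (control-shortens x c))

  length-lower-bound-test⁺ : ∀ {k xs s ys J} (k∈J : k ∈ J) → Clear s → Unique J →
    control (ptest (inGet k)) xs s ≡ continue ys → Yields ys s false →
    All (Accepts (ptest (inGet k) ∷ xs) s) J → suc (L (length (J ─ k∈J))) ≤ length xs
  length-lower-bound-test⁺ {k} {xs} {s} {J = J} k∈J clear uniq c z accs
    with refl ← trans (sym (control-test⁺ {k} {xs} {s} clear)) c = begin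
    suc (L (length (J ─ k∈J)))  ≤⟨ s≤s (length-lower-bound clear (AllPairs.tail uniq⁺) z accs′) ⟩
    suc (length (drop 1 xs))    ≡⟨ Yields-length k-run ⟨
    length xs                   ∎
    where
    open ≤-Reasoning
    uniq⁺ : Unique (k ∷ (J ─ k∈J))
    uniq⁺ = ∷─-unique k∈J uniq
    accs′ : All (Accepts (drop 1 xs) s) (J ─ k∈J)
    accs′ = All-Accepts-continue c (AllPairs.head uniq⁺) (─⁺ k∈J accs)
    k-run : Accepts xs s k
    k-run = Yields-continue (control-test⁺-self {k} {xs} {s}) (All.lookup accs k∈J)

  length-lower-bound-pending : ∀ {xs s J p} → Clear s → Unique (p ∷ J) → Yields xs s false →
    All (Accepts xs s) J → Accepts (drop 1 xs) s p → L (suc (length J)) ≤ suc (length xs)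
  length-lower-bound-pending _ _ (halted _) [] p-run = +-monoʳ-≤ 2 (Yields-nonempty p-run)
  length-lower-bound-pending _ _ (halted o) (acc ∷ _) _ with trans (sym o) (Yields-halt acc)
  ... | ()
  length-lower-bound-pending {s = s} {J} {p} clear uniq (continued {x} {xs} {ys = ys} c z)
    accs p-run with testView J x
  ... | test⁺ k∈J = begin
    L (suc (length J))          ≡⟨ cong (L ∘ suc) (length-removeAt′ J _) ⟩
    L (2 + length (J ─ k∈J))    ≡⟨ L-+2 (length (J ─ k∈J)) ⟩
    3 + L (length (J ─ k∈J))    ≤⟨ +-monoʳ-≤ 2 (length-lower-bound-test⁺ k∈J clear uniq⁻ c z accs) ⟩
    2 + length xs               ∎
    where
    open ≤-Reasoning
    uniq⁻ : Unique J
    uniq⁻ = AllPairs.tail uniq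
  ... | test⁻ {k} k∈J with refl ← trans (sym (control-test⁻ {k} {xs} {s} clear)) c = begin
    L (suc (length J))                ≡⟨ cong (L ∘ suc) (length-removeAt′ J _) ⟩
    L (suc (length (p ∷ (J ─ k∈J))))  ≤⟨ length-lower-bound-pending clear uniq⁺ z accs′ k-run ⟩
    suc (length xs)                   ≤⟨ n≤1+n _ ⟩
    2 + length xs                     ∎
    where
    open ≤-Reasoning
    uniq⁺ : Unique (k ∷ p ∷ (J ─ k∈J))
    uniq⁺ = ∷─-unique (there k∈J) uniq
    accs′ : All (Accepts xs s) (p ∷ (J ─ k∈J))
    accs′ = p-run ∷ All-Accepts-continue c (All.tail (AllPairs.head uniq⁺)) (─⁺ k∈J accs)
    k-run : Accepts (drop 1 xs) s k
    k-run = Yields-continue (control-test⁻-self {k} {xs} {s}) (All.lookup accs k∈J)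
  ... | avoids av = begin
    L (suc (length J))  ≤⟨ L-suc≤ (length J) ⟩
    2 + L (length J)    ≤⟨ +-monoʳ-≤ 2 (length-lower-bound clear′ (AllPairs.tail uniq) z accs′) ⟩
    2 + length ys       ≤⟨ +-monoʳ-≤ 2 (control-shortens x c) ⟩
    2 + length xs       ∎
    where
    open ≤-Reasoning
    clear′ : Clear (effect x s)
    clear′ = Clear-effect x clear
    accs′ : All (Accepts ys (effect x s)) J
    accs′ = All-Accepts-continue c av accs

Computes⇒Yields : ∀ {n X f} → Computes n X f → (inp : ℕ → Bool) →
                  Yields X (st inp false (λ _ → false)) (f (tabulate (inp ∘ toℕ)))
Computes⇒Yields {X = X} (_ , computes) inp
  with _ , e , o ← computes (tabulate (inp ∘ toℕ)) inp (λ _ → false)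
                            (λ i → sym (lookup∘tabulate (inp ∘ toℕ) i)) (λ _ _ → refl)
  = subst (Yields X _) o (run⇒Yields (suc (len X)) X _ e)

tstnz-zeros : ∀ n → tstnz n (tabulate (λ _ → false)) ≡ false
tstnz-zeros zero    = refl
tstnz-zeros (suc n) = tstnz-zeros n

tstnz-tabulate : ∀ {n} (g : Fin n → Bool) i → g i ≡ true → tstnz n (tabulate g) ≡ true
tstnz-tabulate g Fin.zero    e = cong (_∨ tstnz _ (tabulate (g ∘ Fin.suc))) e
tstnz-tabulate g (Fin.suc i) e =
  trans (cong (g Fin.zero ∨_) (tstnz-tabulate (g ∘ Fin.suc) i e)) (∨-zeroʳ _)

tstnz-tabulate-toℕ : ∀ {n j} (inp : ℕ → Bool) → j < n → inp j ≡ true →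
                     tstnz n (tabulate (inp ∘ toℕ)) ≡ true
tstnz-tabulate-toℕ inp j<n e =
  tstnz-tabulate (inp ∘ toℕ) (fromℕ< j<n) (trans (cong inp (toℕ-fromℕ< j<n)) e)

theorem1 : (n : ℕ) → 1 ≤ n → (X : IS) → Computes n X (tstnz n) → L n ≤ len X
theorem1 n _ X computes = begin
  L n                      ≡⟨ cong L (length-downFrom n) ⟨
  L (length (downFrom n))  ≤⟨ length-lower-bound (λ _ → refl) (downFrom⁺ n) zero-run unit-runs ⟩
  len X                    ∎
  where
  open ≤-Reasoning
  zeros : State
  zeros = st (λ _ → false) false (λ _ → false)
  zero-run : Yields X zeros false
  zero-run = subst (Yields X zeros) (tstnz-zeros n) (Computes⇒Yields computes (λ _ → false))
  unit-run : ∀ {j} → j ∈ downFrom n → Accepts X zeros j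
  unit-run {j} j∈ = subst (Yields X (setInput zeros j))
    (tstnz-tabulate-toℕ (update (λ _ → false) j true) (∈-downFrom⁻ j∈) (update-self _ j true))
    (Computes⇒Yields computes (update (λ _ → false) j true))
  unit-runs : All (Accepts X zeros) (downFrom n)
  unit-runs = All.tabulate unit-run
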